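{- Let $(\Sigma,<)$ be a finite totally ordered alphabet, let $w\in\Sigma^+$, let $(\ell_1,\ldots,\ell_h)$ be a non-increasing maximal chain for the prefix order in $\mathrm{CFL}_{in}(w)$, where $\ell_1$ is the first element of $\mathrm{CFL}_{in}(w)$, and let $\mathrm{ICFL}(w)=(m_1,\ldots,m_k)$. If $\ell_1\cdots\ell_h$ is an inverse Lyndon word, then $m_1=\ell_1\cdots\ell_h$.
   Context: Words are elements of $\Sigma^*$; $1$ empty word, $\Sigma^+=\Sigma^*\setminus\{1\}$. Lexicographic order $\prec$: $x\prec y$ if $x$ is a proper prefix of $y$, or $x=ras$, $y=rbt$ with $a,b\in\Sigma$, $a<b$. For nonempty $x,y$, $x\ll y$ means $x\prec y$ and $x$ not a proper prefix of $y$. $x\le_p y$: $x$ prefix of $y$; $x\ge_p y$: $y$ prefix of $x$. Inverse order $<_{in}$: $b<_{in}a\iff a<b$; $\prec_{in}$ the induced lexicographic order. An anti-Lyndon word is a nonempty primitive word strictly smaller for $\prec_{in}$ than all its other conjugates. $\mathrm{CFL}_{in}(w)$ is the unique sequence $(\ell_1,\ldots,\ell_n)$ of anti-Lyndon words with $w=\ell_1\cdots\ell_n$, $\ell_1\succeq_{in}\cdots\succeq_{in}\ell_n$. A non-increasing maximal chain for the prefix order in $\mathrm{CFL}_{in}(w)$ is a block $\ell_r,\ldots,\ell_t$ of consecutive factors ($r\le t$) with $\ell_r\ge_p\cdots\ge_p\ell_t$, such that $\ell_r$ is not a prefix of $\ell_{r-1}$ if $r>1$ and $\ell_{t+1}$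 not a prefix of $\ell_t$ if $t<n$. An inverse Lyndon word is a $u\in\Sigma^+$ with $s\prec u$ for each nonempty proper suffix $s$ of $u$. For $w=pv$ with $p$ an inverse Lyndon nonempty proper prefix, a bounded right extension of $p$ is a nonempty prefix $\overline p$ of $v$ such that $\overline p$ is inverse Lyndon, $pz'$ is inverse Lyndon for every proper nonempty prefix $z'$ of $\overline p$, $p\overline p$ is not inverse Lyndon, and $p\ll\overline p$; if $w$ is not inverse Lyndon exactly one such pair exists, the canonical pair of $w$. $\mathrm{ICFL}(w)$: if $w$ is inverse Lyndon, $\mathrm{ICFL}(w)=(w)$; otherwise with canonical pair $(p,\overline p)$, $w=pv$, $\overline p=rb$ ($b\in\Sigma$), $\mathrm{ICFL}(v)=(m'_1,\ldots,m'_{k'})$: $\mathrm{ICFL}(w)=(p,m'_1,\ldots,m'_{k'})$ if $\overline p\le_p m'_1$, and $(pm'_1,m'_2,\ldots,m'_{k'})$ if $m'_1\le_p r$ (exactly one case occurs). -}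

module Defs where

open import Data.Nat using (ℕ; _≤_)
open import Data.Fin using (Fin) renaming (_<_ to _<ᶠ_)
open import Data.List using (List; []; _∷_; _++_; [_]; concat; replicate)
open import Data.List.Relation.Unary.All using (All)
open import Data.List.Relation.Unary.Linked using (Linked)
open import Data.Product using (Σ; ∃; _×_; _,_)
open import Data.Sum using (_⊎_)
open import Data.Unit using (⊤)
open import Relation.Nullary using (¬_)
open import Relation.Binary.PropositionalEquality using (_≡_; _≢_)

-- The finite totally ordered alphabet (Σ,<) is modelled as Fin n with its
-- usual order (every finite total order is isomorphic to one of these).
-- Words are lists of letters; the empty word 1 is [].

module _ {n : ℕ} where

  Word : Set
  Word = List (Fin n)

  Prefix : Word → Word → Set
  Prefix x y = ∃ λ s → y ≡ x ++ s

  ProperPrefix : Word → Word → Set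
  ProperPrefix x y = ∃ λ c → ∃ λ s → y ≡ x ++ (c ∷ s)

  Lex : (Fin n → Fin n → Set) → Word → Word → Set
  Lex R x y =
    ProperPrefix x y ⊎
    (∃ λ r → ∃ λ a → ∃ λ b → ∃ λ s → ∃ λ t →
       x ≡ r ++ (a ∷ s) × y ≡ r ++ (b ∷ t) × R a b)

  _≺_ : Word → Word → Set
  _≺_ = Lex _<ᶠ_

  _<in_ : Fin n → Fin n → Set
  b <in a = a <ᶠ b

  _≺in_ : Word → Word → Set
  _≺in_ = Lex _<in_

  _⪯in_ : Word → Word → Set
  x ⪯in y = x ≡ y ⊎ x ≺in y

  _≪_ : Word → Word → Set
  x ≪ y = x ≢ [] × y ≢ [] × x ≺ y × ¬ ProperPrefix x y

  Primitive : Word → Set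
  Primitive w = w ≢ [] × (∀ (u : Word) (k : ℕ) → 2 ≤ k → w ≢ concat (replicate k u))

  AntiLyndon : Word → Set
  AntiLyndon w = Primitive w ×
    (∀ (u v : Word) → w ≡ u ++ v → v ++ u ≢ w → w ≺in (v ++ u))

  IsCFLin : Word → List Word → Set
  IsCFLin w ls = All AntiLyndon ls × concat ls ≡ w × Linked (λ x y → y ⪯in x) ls

  InverseLyndon : Word → Set
  InverseLyndon u = u ≢ [] ×
    (∀ (pre s : Word) → pre ≢ [] → s ≢ [] → u ≡ pre ++ s → s ≺ u)

  BoundedRightExt : Word → Word → Word → Set
  BoundedRightExt p v pbar =
    p ≢ [] × v ≢ [] × InverseLyndon p ×
    pbar ≢ [] × Prefix pbar v × InverseLyndon pbar ×
    (∀ z' → z' ≢ [] → ProperPrefix z' pbar → InverseLyndon (p ++ z')) ×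
    ¬ InverseLyndon (p ++ pbar) ×
    (p ≪ pbar)

  -- IsICFL w ms : ms = ICFL(w), following the recursive definition
  -- (the canonical pair (p, pbar) of w is given by w = p v and
  -- BoundedRightExt p v pbar).
  data IsICFL : Word → List Word → Set where
    icfl-inv : ∀ {w} → InverseLyndon w → IsICFL w (w ∷ [])
    icfl-new : ∀ {w p v pbar m ms} → ¬ InverseLyndon w → w ≡ p ++ v →
               BoundedRightExt p v pbar → IsICFL v (m ∷ ms) →
               Prefix pbar m → IsICFL w (p ∷ m ∷ ms)
    icfl-glue : ∀ {w p v pbar r b m ms} → ¬ InverseLyndon w → w ≡ p ++ v →
               BoundedRightExt p v pbar → pbar ≡ r ++ [ b ] →
               IsICFL v (m ∷ ms) → Prefix m r →
               IsICFL w ((p ++ m) ∷ ms)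

  lastOf : Word → List Word → Word
  lastOf x [] = x
  lastOf _ (y ∷ ys) = lastOf y ys

  -- right-maximality condition of a chain ending in x and followed by rest
  StopsBefore : Word → List Word → Set
  StopsBefore x [] = ⊤
  StopsBefore x (y ∷ _) = ¬ Prefix y x

  -- (ℓ₁ ∷ chain) is a non-increasing maximal chain for the prefix order in ls
  -- starting at the first element ℓ₁ of ls (so the left condition is vacuous).
  InitialMaxPrefixChain : List Word → Word → List Word → Set
  InitialMaxPrefixChain ls ℓ₁ chain =
    ∃ λ rest → ls ≡ (ℓ₁ ∷ chain) ++ rest ×
      Linked (λ x y → Prefix y x) (ℓ₁ ∷ chain) ×
      StopsBefore (lastOf ℓ₁ chain) rest

{-# OPTIONS --safe #-}
-- Write w = x y with x = ℓ₁ ⋯ ℓ_h and u = ℓ_h. Anti-Lyndon words are strictly inverse Lyndon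
-- (every proper suffix is ⊏ the word), and maximality of the chain makes y empty or begin with an
-- anti-Lyndon ℓ′ with u ⊏ ℓ′; since x followed by anything beating u is not inverse Lyndon, y is
-- empty when w is inverse Lyndon. Otherwise let (p, pbar = e f) be the canonical pair of w, where
-- p begins with e g for a letter g < f. As x is inverse Lyndon and p pbar is not, p e = x k
-- overhangs x, and k stays inside the common prefix of u and ℓ′, so k f is a prefix of ℓ′. Then:
--  * p = x: pbar is no longer than ℓ′, while the first ICFL factor of y is at least as long as any
--    strictly inverse Lyndon prefix of y; so the factors are not glued and m₁ = p = x.
--  * p = x p₂ with p₂ ≠ []: ℓ′ would begin with e g and have a proper suffix beginning with e f,
--    contradicting strictness.
--  * p a proper prefix of x: the rest d of x is a border of x, so p = ℓ₁ ⋯ ℓ_(j-1) and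
--    d = ℓ_j ⋯ ℓ_h, and d is a prefix of e. By induction ICFL(v) begins with d, too short to
--    extend pbar, so the factors are glued and m₁ = p d = x.
module Submission where

open import Defs
open import Data.Nat using (ℕ; zero; suc; _+_; _≤_; _<_; s≤s; z≤n; z<s; _≤?_)
open import Data.Nat.Properties
  using (≤-trans; ≤-reflexive; <⇒≱; ≰⇒>; <-irrefl; +-comm; +-cancelˡ-≡; m≤n+m; m<m+n;
         module ≤-Reasoning)
open import Data.Nat.Induction using (<-wellFounded)
open import Data.Fin using (Fin) renaming (_<_ to _<ᶠ_)
import Data.Fin.Properties as Fin
open import Data.List using (List; []; _∷_; _++_; [_]; _∷ʳ_; concat; replicate; length)
open import Data.List.Properties
  using (++-assoc; ++-identityʳ; ++-identityˡ-unique; ++-cancelˡ; ++-conicalˡ; ++-conicalʳ;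
         ∷-injective; length-++; length-++-comm; length-++-≤ˡ; length-++-≤ʳ; concat-++)
open import Data.List.Relation.Unary.All using (All; []; _∷_)
import Data.List.Relation.Unary.All as All
import Data.List.Relation.Unary.All.Properties as All
open import Data.List.Relation.Unary.Linked using (Linked; _∷_)
import Data.List.Relation.Unary.Linked as Linked
open import Data.List.Relation.Unary.Linked.Properties using (Linked⇒All)
open import Data.Product using (∃; ∃-syntax; _×_; _,_; proj₁; proj₂)
open import Data.Sum using (_⊎_; inj₁; inj₂)
import Data.Sum as Sum
open import Data.Empty using (⊥-elim)
open import Function using (_∘_; flip)
open import Induction.WellFounded using (Acc; acc)
open import Relation.Binary using (Rel; tri<; tri≈; tri>)
open import Relation.Nullary using (¬_; yes; no; contradiction)
open import Relation.Binary.PropositionalEquality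
  using (_≡_; _≢_; refl; sym; trans; cong; subst; subst₂; module ≡-Reasoning)

Linked-++⁻ʳ : ∀ {a r} {A : Set a} {R : Rel A r} xs {ys} → Linked R (xs ++ ys) → Linked R ys
Linked-++⁻ʳ [] linked = linked
Linked-++⁻ʳ (_ ∷ xs) linked = Linked-++⁻ʳ xs (Linked.tail linked)

module _ {n : ℕ} where

  private
    variable
      a b c : Fin n
      d p q r s t u v w x y z ℓ ℓ′ pbar s′ u′ v′ : Word {n}
      ls ls₁ ls₂ ms : List (Word {n})
      m : Word {n}

  length-∷ʳ : ∀ (u : Word {n}) → length (u ∷ʳ c) ≡ suc (length u)
  length-∷ʳ u = trans (length-++ u) (+-comm (length u) 1)

  length-<-++-∷ : ∀ (u : Word {n}) → length u < length (u ++ c ∷ s)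
  length-<-++-∷ u = subst (length u <_) (sym (length-++ u)) (m<m+n (length u) z<s)

  length-<-∷-++ : ∀ (p : Word {n}) → length s < length (c ∷ p ++ s)
  length-<-∷-++ {s = s} p = s≤s (length-++-≤ʳ s {p})

  Prefix-refl : ∀ (u : Word {n}) → Prefix u u
  Prefix-refl u = [] , sym (++-identityʳ u)

  Prefix-trans : Prefix u v → Prefix v w → Prefix u w
  Prefix-trans {u = u} (s , refl) (t , refl) = s ++ t , ++-assoc u s t

  Prefix-length : Prefix u v → length u ≤ length v
  Prefix-length {u = u} (_ , refl) = length-++-≤ˡ u

  Prefix-++⁺ : ∀ x → Prefix u v → Prefix (x ++ u) (x ++ v)
  Prefix-++⁺ {u = u} x (s , refl) = s , sym (++-assoc x u s)

  Prefix-++⁻ : ∀ x → Prefix (x ++ u) (x ++ v) → Prefix u v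
  Prefix-++⁻ {u = u} x (s , eq) = s , ++-cancelˡ x _ _ (trans eq (++-assoc x u s))

  Prefix∧length≥⇒≡ : Prefix u v → length v ≤ length u → u ≡ v
  Prefix∧length≥⇒≡ {u = u} ([] , refl) _ = sym (++-identityʳ u)
  Prefix∧length≥⇒≡ {u = u} (_ ∷ _ , refl) |v|≤|u| = contradiction |v|≤|u| (<⇒≱ (length-<-++-∷ u))

  Prefix-total : Prefix u w → Prefix v w → Prefix u v ⊎ ProperPrefix v u
  Prefix-total {u = []} {v = v} _ _ = inj₁ (v , refl)
  Prefix-total {u = a ∷ u} {v = []} _ _ = inj₂ (a , u , refl)
  Prefix-total {u = a ∷ u} {v = b ∷ v} (s , refl) (t , eq) with ∷-injective eq
  ... | refl , eq′ with Prefix-total {u = u} {v = v} (s , refl) (t , eq′)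
  ...   | inj₁ (k , refl) = inj₁ (k , refl)
  ...   | inj₂ (c , k , refl) = inj₂ (c , k , refl)

  Prefix-by-length : Prefix u w → Prefix v w → length u ≤ length v → Prefix u v
  Prefix-by-length {v = v} u≤w v≤w |u|≤|v| with Prefix-total u≤w v≤w
  ... | inj₁ u≤v = u≤v
  ... | inj₂ (_ , _ , refl) = contradiction |u|≤|v| (<⇒≱ (length-<-++-∷ v))

  Prefix-∷ʳ-stop : Prefix u w → Prefix (v ∷ʳ c) w → ¬ Prefix (v ∷ʳ c) u → Prefix u v
  Prefix-∷ʳ-stop {u = u} {v = v} {c = c} u≤w vc≤w vc≰u with length u ≤? length v
  ... | yes |u|≤|v| = Prefix-by-length u≤w (Prefix-trans ([ c ] , refl) vc≤w) |u|≤|v|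
  ... | no |u|≰|v| = contradiction (Prefix-by-length vc≤w u≤w |vc|≤|u|) vc≰u
    where
    |vc|≤|u| : length (v ∷ʳ c) ≤ length u
    |vc|≤|u| = subst (_≤ length u) (sym (length-∷ʳ v)) (≰⇒> |u|≰|v|)

  -- u ⊏ v: u and v differ somewhere, and at the first difference u has the smaller letter
  -- (the paper's u ≪ v).
  infix 4 _⊏_ _≼_
  data _⊏_ : Word {n} → Word {n} → Set where
    here  : a <ᶠ b → a ∷ s ⊏ b ∷ t
    there : s ⊏ t → c ∷ s ⊏ c ∷ t

  ⊏-asym : u ⊏ v → ¬ v ⊏ u
  ⊏-asym (here a<b) (here b<a) = Fin.<-asym a<b b<a
  ⊏-asym (here a<a) (there _) = Fin.<-irrefl refl a<a
  ⊏-asym (there _) (here a<a) = Fin.<-irrefl refl a<a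
  ⊏-asym (there u⊏v) (there v⊏u) = ⊏-asym u⊏v v⊏u

  ⊏-irrefl : ¬ u ⊏ u
  ⊏-irrefl u⊏u = ⊏-asym u⊏u u⊏u

  ⊏-extend : u ⊏ v → Prefix u u′ → Prefix v v′ → u′ ⊏ v′
  ⊏-extend (here a<b) (_ , refl) (_ , refl) = here a<b
  ⊏-extend (there u⊏v) (_ , refl) (_ , refl) = there (⊏-extend u⊏v (_ , refl) (_ , refl))

  ⊏-++ˡ : ∀ x → u ⊏ v → x ++ u ⊏ x ++ v
  ⊏-++ˡ [] u⊏v = u⊏v
  ⊏-++ˡ (_ ∷ x) u⊏v = there (⊏-++ˡ x u⊏v)

  ⊏-∷ʳ : ∀ x → a <ᶠ b → x ∷ʳ a ⊏ x ∷ʳ b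
  ⊏-∷ʳ x a<b = ⊏-++ˡ x (here a<b)

  ∷ʳ≢[] : ∀ (u : Word {n}) → u ∷ʳ c ≢ []
  ∷ʳ≢[] {c = c} u uc≡[] with ++-conicalʳ u [ c ] uc≡[]
  ... | ()

  Prefix-≢[] : Prefix u v → u ≢ [] → v ≢ []
  Prefix-≢[] {u = u} (s , refl) u≢[] = u≢[] ∘ ++-conicalˡ u s

  ⊏⇒≢[] : u ⊏ v → v ≢ []
  ⊏⇒≢[] (here _) ()
  ⊏⇒≢[] (there _) ()

  ⊏⇒¬Prefix : u ⊏ v → ¬ Prefix u v
  ⊏⇒¬Prefix {v = v} u⊏v u≤v = ⊏-irrefl (⊏-extend u⊏v u≤v (Prefix-refl v))

  ⊏⇒¬Prefix⁻ : u ⊏ v → ¬ Prefix v u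
  ⊏⇒¬Prefix⁻ {u = u} u⊏v v≤u = ⊏-irrefl (⊏-extend u⊏v (Prefix-refl u) v≤u)

  ⊏-split : u ⊏ v → ∃[ r ] ∃[ a ] ∃[ b ] a <ᶠ b × Prefix (r ∷ʳ a) u × Prefix (r ∷ʳ b) v
  ⊏-split (here a<b) = [] , _ , _ , a<b , (_ , refl) , (_ , refl)
  ⊏-split (there {c = c} u⊏v) with ⊏-split u⊏v
  ... | r , a , b , a<b , ra≤u , rb≤v =
    c ∷ r , a , b , a<b , Prefix-++⁺ [ c ] ra≤u , Prefix-++⁺ [ c ] rb≤v

  _≼_ : Word {n} → Word {n} → Set
  u ≼ v = Prefix u v ⊎ u ⊏ v

  ≼-total : ∀ u v → u ≼ v ⊎ v ≼ u
  ≼-total [] v = inj₁ (inj₁ (v , refl))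
  ≼-total (a ∷ u) [] = inj₂ (inj₁ (a ∷ u , refl))
  ≼-total (a ∷ u) (b ∷ v) with Fin.<-cmp a b
  ... | tri< a<b _ _ = inj₁ (inj₂ (here a<b))
  ... | tri> _ _ b<a = inj₂ (inj₂ (here b<a))
  ... | tri≈ _ refl _ = Sum.map ∷-≼ ∷-≼ (≼-total u v)
    where
    ∷-≼ : ∀ {s t} → s ≼ t → a ∷ s ≼ a ∷ t
    ∷-≼ = Sum.map (Prefix-++⁺ [ a ]) there

  ⊏-≼-asym : u ⊏ v → ¬ v ≼ u
  ⊏-≼-asym u⊏v = Sum.[ ⊏⇒¬Prefix⁻ u⊏v , ⊏-asym u⊏v ]

  ⊏-trichotomy : length u ≡ length v → u ⊏ v ⊎ u ≡ v ⊎ v ⊏ u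
  ⊏-trichotomy {u = u} {v = v} |u|≡|v| with ≼-total u v
  ... | inj₁ (inj₁ u≤v) = inj₂ (inj₁ (Prefix∧length≥⇒≡ u≤v (≤-reflexive (sym |u|≡|v|))))
  ... | inj₁ (inj₂ u⊏v) = inj₁ u⊏v
  ... | inj₂ (inj₁ v≤u) = inj₂ (inj₁ (sym (Prefix∧length≥⇒≡ v≤u (≤-reflexive |u|≡|v|))))
  ... | inj₂ (inj₂ v⊏u) = inj₂ (inj₂ v⊏u)

  ≼-prefixes : s′ ≼ u′ → Prefix s s′ → Prefix u u′ → length s ≤ length u → s ≼ u
  ≼-prefixes {s = s} {u = u} s′≼u′ s≤s′ u≤u′ |s|≤|u| with ≼-total s u
  ... | inj₁ s≼u = s≼u
  ... | inj₂ (inj₁ u≤s) = inj₁ (Prefix-by-length (Prefix-refl s) u≤s |s|≤|u|)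
  ... | inj₂ (inj₂ u⊏s) = contradiction s′≼u′ (⊏-≼-asym (⊏-extend u⊏s u≤u′ s≤s′))

  ≺⇒≼ : u ≺ v → u ≼ v
  ≺⇒≼ (inj₁ (c , s , refl)) = inj₁ (c ∷ s , refl)
  ≺⇒≼ (inj₂ (r , _ , _ , _ , _ , refl , refl , a<b)) = inj₂ (⊏-++ˡ r (here a<b))

  ⊏⇒≺ : u ⊏ v → u ≺ v
  ⊏⇒≺ u⊏v with ⊏-split u⊏v
  ... | r , a , b , a<b , (s , refl) , (t , refl) =
    inj₂ (r , a , b , s , t , ++-assoc r [ a ] s , ++-assoc r [ b ] t , a<b)

  ≺in⇒⊐ : u ≺in v → ProperPrefix u v ⊎ v ⊏ u
  ≺in⇒⊐ (inj₁ u<v) = inj₁ u<v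
  ≺in⇒⊐ (inj₂ (r , _ , _ , _ , _ , refl , refl , b<a)) = inj₂ (⊏-++ˡ r (here b<a))

  -- u ≡ [] ⊎ InverseLyndon u, in a form that is closed under taking prefixes.
  InverseLyndon₀ : Word {n} → Set
  InverseLyndon₀ u = ∀ p s → u ≡ p ++ s → s ≼ u

  InverseLyndon⇒₀ : InverseLyndon u → InverseLyndon₀ u
  InverseLyndon⇒₀ _ [] s refl = inj₁ (Prefix-refl s)
  InverseLyndon⇒₀ _ (_ ∷ _) [] _ = inj₁ (_ , refl)
  InverseLyndon⇒₀ (_ , below) p@(_ ∷ _) s@(_ ∷ _) eq = ≺⇒≼ (below p s (λ ()) (λ ()) eq)

  ₀⇒InverseLyndon : u ≢ [] → InverseLyndon₀ u → InverseLyndon u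
  ₀⇒InverseLyndon {u = u} u≢[] il = u≢[] , below
    where
    below : ∀ p s → p ≢ [] → s ≢ [] → u ≡ p ++ s → s ≺ u
    below p s p≢[] _ u≡ps with il p s u≡ps
    ... | inj₂ s⊏u = ⊏⇒≺ s⊏u
    ... | inj₁ (c ∷ k , u≡sck) = inj₁ (c , k , u≡sck)
    ... | inj₁ ([] , u≡s[]) =
      contradiction (++-identityˡ-unique p (trans (sym (trans u≡s[] (++-identityʳ s))) u≡ps)) p≢[]

  InverseLyndon₀-prefix : Prefix u w → InverseLyndon₀ w → InverseLyndon₀ u
  InverseLyndon₀-prefix (z , refl) il p s refl =
    ≼-prefixes (il p (s ++ z) (++-assoc p s z)) (z , refl) (z , refl) (length-++-≤ʳ s {p})

  InverseLyndon₀-border : Prefix s (p ++ s) → InverseLyndon₀ (p ++ s) → InverseLyndon₀ s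
  InverseLyndon₀-border {p = p} s≤ps il q t refl =
    ≼-prefixes (il (p ++ q) t (sym (++-assoc p q t))) (Prefix-refl t) s≤ps (length-++-≤ʳ t {q})

  ¬InverseLyndon₀-++-⊐ : Prefix u x → u ⊏ v → ¬ InverseLyndon₀ (x ++ v)
  ¬InverseLyndon₀-++-⊐ {x = x} {v = v} u≤x u⊏v il =
    ⊏-≼-asym (⊏-extend u⊏v (Prefix-trans u≤x (v , refl)) (Prefix-refl v)) (il x v refl)

  StrictlyInverseLyndon : Word {n} → Set
  StrictlyInverseLyndon u = ∀ p s → p ≢ [] → s ≢ [] → u ≡ p ++ s → s ⊏ u

  StrictlyInverseLyndon⇒¬inner-⊐ :
    StrictlyInverseLyndon ℓ → z ≢ [] → Prefix (z ++ t) ℓ → Prefix q ℓ → ¬ q ⊏ t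
  StrictlyInverseLyndon⇒¬inner-⊐ {z = z} {t = t} strict z≢[] (s , refl) q≤ℓ q⊏t =
    ⊏-asym (strict z (t ++ s) z≢[] (⊏⇒≢[] q⊏t ∘ ++-conicalˡ t s) (++-assoc z t s))
           (⊏-extend q⊏t q≤ℓ (s , refl))

  _^_ : Word {n} → ℕ → Word {n}
  t ^ k = concat (replicate k t)

  ^-+ : ∀ t i j → t ^ (i + j) ≡ t ^ i ++ t ^ j
  ^-+ t zero j = refl
  ^-+ t (suc i) j = trans (cong (t ++_) (^-+ t i j)) (sym (++-assoc t (t ^ i) (t ^ j)))

  CommonPower : Word {n} → Word {n} → Set
  CommonPower x y = ∃[ t ] ∃[ i ] ∃[ j ] x ≡ t ^ i × y ≡ t ^ j

  CommonPower-++ : CommonPower x y → CommonPower x (x ++ y)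
  CommonPower-++ (t , i , j , refl , refl) = t , i , i + j , refl , sym (^-+ t i j)

  CommonPower-swap : CommonPower x y → CommonPower y x
  CommonPower-swap (t , i , j , x≡ , y≡) = t , j , i , y≡ , x≡

  commute-shift : ∀ (x y : Word {n}) → x ++ (x ++ y) ≡ (x ++ y) ++ x → x ++ y ≡ y ++ x
  commute-shift x y eq = ++-cancelˡ x _ _ (trans eq (++-assoc x y x))

  commute⇒CommonPower : x ++ y ≡ y ++ x → CommonPower x y
  commute⇒CommonPower {x = x} {y = y} = go x y (<-wellFounded (length (x ++ y)))
    where
    go : ∀ (x y : Word {n}) → Acc _<_ (length (x ++ y)) → x ++ y ≡ y ++ x → CommonPower x y
    go [] y _ _ = y , 0 , 1 , refl , sym (++-identityʳ y)
    go x [] _ _ = x , 1 , 0 , sym (++-identityʳ x) , refl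
    go (a ∷ x) (b ∷ y) (acc shorter) xy≡yx
      with Prefix-total {u = a ∷ x} {v = b ∷ y} (b ∷ y , refl) (a ∷ x , xy≡yx)
    ... | inj₁ (y′ , refl) = CommonPower-++
      (go (a ∷ x) y′ (shorter (length-<-∷-++ {s = a ∷ x ++ y′} {c = a} x))
          (commute-shift (a ∷ x) y′ xy≡yx))
    ... | inj₂ (c , x′ , refl) = CommonPower-swap (CommonPower-++
      (go (b ∷ y) (c ∷ x′) (shorter (length-<-++-∷ (b ∷ y ++ c ∷ x′)))
          (commute-shift (b ∷ y) (c ∷ x′) (sym xy≡yx))))

  commute⇒¬Primitive : x ≢ [] → y ≢ [] → x ++ y ≡ y ++ x → ¬ Primitive (x ++ y)
  commute⇒¬Primitive x≢[] y≢[] xy≡yx (_ , not-power) with commute⇒CommonPower xy≡yx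
  ... | _ , zero , _ , x≡[] , _ = x≢[] x≡[]
  ... | _ , suc _ , zero , _ , y≡[] = y≢[] y≡[]
  ... | t , suc i , suc j , refl , refl =
    not-power t (suc i + suc j) (s≤s (≤-trans (s≤s z≤n) (m≤n+m (suc j) i)))
              (sym (^-+ t (suc i) (suc j)))

  AntiLyndon⇒¬⊏-conjugate : AntiLyndon w → ∀ x y → w ≡ x ++ y → ¬ w ⊏ y ++ x
  AntiLyndon⇒¬⊏-conjugate (_ , above-conjugates) x y refl w⊏yx
    with ≺in⇒⊐ (above-conjugates x y refl (λ yx≡w → ⊏-irrefl (subst (x ++ y ⊏_) yx≡w w⊏yx)))
  ... | inj₁ (_ , _ , yx≡) =
    <-irrefl (trans (sym (length-++-comm y x)) (cong length yx≡)) (length-<-++-∷ (x ++ y))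
  ... | inj₂ yx⊏w = ⊏-asym w⊏yx yx⊏w

  AntiLyndon⇒StrictlyInverseLyndon : AntiLyndon w → StrictlyInverseLyndon w
  AntiLyndon⇒StrictlyInverseLyndon _ [] _ p≢[] _ _ = contradiction refl p≢[]
  AntiLyndon⇒StrictlyInverseLyndon anti p@(a ∷ p′) s p≢[] s≢[] refl with ≼-total s (p ++ s)
  ... | inj₁ (inj₂ s⊏w) = s⊏w
  ... | inj₂ (inj₁ w≤s) =
    contradiction (Prefix-length w≤s) (<⇒≱ (length-<-∷-++ {s = s} {c = a} p′))
  ... | inj₂ (inj₂ w⊏s) =
    ⊥-elim (AntiLyndon⇒¬⊏-conjugate anti p s refl (⊏-extend w⊏s (Prefix-refl _) (p , refl)))
  ... | inj₁ (inj₁ (z , ps≡sz)) with ⊏-trichotomy |p|≡|z|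
    where
    |p|≡|z| : length p ≡ length z
    |p|≡|z| = +-cancelˡ-≡ (length s) _ _ (begin
      length s + length p  ≡⟨ +-comm (length s) (length p) ⟩
      length p + length s  ≡⟨ sym (length-++ p) ⟩
      length (p ++ s)      ≡⟨ cong length ps≡sz ⟩
      length (s ++ z)      ≡⟨ length-++ s ⟩
      length s + length z  ∎)
      where open ≡-Reasoning
  ...   | inj₁ p⊏z =
    ⊥-elim (AntiLyndon⇒¬⊏-conjugate anti s z ps≡sz (⊏-extend p⊏z (s , refl) (s , refl)))
  ...   | inj₂ (inj₂ z⊏p) =
    ⊥-elim (AntiLyndon⇒¬⊏-conjugate anti p s refl
              (subst (_⊏ s ++ p) (sym ps≡sz) (⊏-++ˡ s z⊏p)))
  ...   | inj₂ (inj₁ refl) = ⊥-elim (commute⇒¬Primitive p≢[] s≢[] ps≡sz (proj₁ anti))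

  BoundedRightExt-¬InverseLyndon₀ : BoundedRightExt p v pbar → ¬ InverseLyndon₀ (p ++ pbar)
  BoundedRightExt-¬InverseLyndon₀ {p = p} {pbar = pbar} (p≢[] , _ , _ , _ , _ , _ , _ , ¬il , _) il
    =
    ¬il (₀⇒InverseLyndon (p≢[] ∘ ++-conicalˡ p pbar) il)

  BoundedRightExt-inner : BoundedRightExt p v pbar → ProperPrefix q pbar → InverseLyndon₀ (p ++ q)
  BoundedRightExt-inner {p = p} {q = []} (_ , _ , il-p , _) _ =
    subst InverseLyndon₀ (sym (++-identityʳ p)) (InverseLyndon⇒₀ il-p)
  BoundedRightExt-inner {q = _ ∷ _} (_ , _ , _ , _ , _ , _ , il-ext , _) q<pbar =
    InverseLyndon⇒₀ (il-ext _ (λ ()) q<pbar)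

  -- p and pbar first differ at the last letter of pbar, since p z′ is inverse Lyndon for
  -- every proper prefix z′ of pbar.
  BoundedRightExt-shape : BoundedRightExt p v pbar →
    ∃[ e ] ∃[ f ] ∃[ g ] pbar ≡ e ∷ʳ f × Prefix (e ∷ʳ g) p × g <ᶠ f
  BoundedRightExt-shape (_ , _ , _ , _ , _ , _ , _ , _ , _ , _ , inj₁ p<pbar , p≮pbar) =
    ⊥-elim (p≮pbar p<pbar)
  BoundedRightExt-shape
    (_ , _ , _ , _ , _ , _ , _ , _ , _ , _ , inj₂ (r , g , f , k , [] , refl , refl , g<f) , _) =
    r , f , g , refl , (k , sym (++-assoc r [ g ] k)) , g<f
  BoundedRightExt-shape
    bre@(_ , _ , _ , _ , _ , _ , _ , _ , _ , _ , inj₂ (r , g , f , k , c ∷ t , refl , refl , g<f) , _)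
    =
    ⊥-elim (¬InverseLyndon₀-++-⊐ (Prefix-refl _) (⊏-++ˡ r (here g<f))
              (BoundedRightExt-inner bre (c , t , sym (++-assoc r [ f ] (c ∷ t)))))

  BoundedRightExt⇒strict-prefix-≤ :
    BoundedRightExt p v pbar → Prefix ℓ (p ++ v) → StrictlyInverseLyndon ℓ → length ℓ ≤ length p
  BoundedRightExt⇒strict-prefix-≤ {p = p} {v = v} bre@(p≢[] , _ , _ , _ , pbar≤v , _) ℓ≤pv strict
    with Prefix-total ℓ≤pv (v , refl) | BoundedRightExt-shape bre
  ... | inj₁ ℓ≤p | _ = Prefix-length ℓ≤p
  ... | inj₂ (c , t , refl) | e , f , g , refl , eg≤p , g<f =
    ⊥-elim (⊏⇒¬Prefix (strict p (c ∷ t) p≢[] (λ ()) refl) t≤ℓ)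
    where
    eg≤ℓ : Prefix (e ∷ʳ g) (p ++ c ∷ t)
    eg≤ℓ = Prefix-trans eg≤p (c ∷ t , refl)
    ¬ef≤t : ¬ Prefix (e ∷ʳ f) (c ∷ t)
    ¬ef≤t ef≤t = StrictlyInverseLyndon⇒¬inner-⊐ strict p≢[] (Prefix-++⁺ p ef≤t) eg≤ℓ (⊏-∷ʳ e g<f)
    t≤ℓ : Prefix (c ∷ t) (p ++ c ∷ t)
    t≤ℓ = Prefix-trans (Prefix-∷ʳ-stop (Prefix-++⁻ p ℓ≤pv) pbar≤v ¬ef≤t)
                       (Prefix-trans ([ g ] , refl) eg≤ℓ)

  ICFL-head-≥-strict-prefix :
    IsICFL y (m ∷ ms) → Prefix ℓ y → StrictlyInverseLyndon ℓ → length ℓ ≤ length m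
  ICFL-head-≥-strict-prefix (icfl-inv _) ℓ≤y _ = Prefix-length ℓ≤y
  ICFL-head-≥-strict-prefix (icfl-new _ refl bre _ _) ℓ≤y strict =
    BoundedRightExt⇒strict-prefix-≤ bre ℓ≤y strict
  ICFL-head-≥-strict-prefix (icfl-glue {p = p} _ refl bre _ _ _) ℓ≤y strict =
    ≤-trans (BoundedRightExt⇒strict-prefix-≤ bre ℓ≤y strict) (length-++-≤ˡ p)

  record Chain (u : Word {n}) (ls : List (Word {n})) : Set where
    field
      strict        : All StrictlyInverseLyndon ls
      linked        : Linked (flip Prefix) ls
      inverseLyndon : InverseLyndon₀ (concat ls)
      extends-u     : All (Prefix u) ls

  Chain⇒Prefix : Chain u (ℓ ∷ ls) → Prefix u (concat (ℓ ∷ ls))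
  Chain⇒Prefix record { extends-u = u≤ℓ ∷ _ } = Prefix-trans u≤ℓ (_ , refl)

  Linked-Prefix⇒All : Linked (flip Prefix) ls → All (λ ℓ → Prefix ℓ (concat ls)) ls
  Linked-Prefix⇒All {ls = []} _ = []
  Linked-Prefix⇒All {ls = ℓ ∷ ls} =
    Linked⇒All (λ j≤i k≤j → Prefix-trans k≤j j≤i) (concat ls , refl)

  -- A cut inside a factor ℓ would make a proper suffix of ℓ a prefix of x, hence of ℓ.
  factor-boundary : All StrictlyInverseLyndon ls → All (λ ℓ → Prefix ℓ x) ls → concat ls ≡ p ++ d →
                    Prefix d x → ∃[ ls₁ ] ∃[ ls₂ ] ls ≡ ls₁ ++ ls₂ × d ≡ concat ls₂
  factor-boundary {ls = []} {p = p} {d = d} _ _ pd≡[] _ =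
    [] , [] , refl , ++-conicalʳ p d (sym pd≡[])
  factor-boundary {ls = ℓ ∷ ls} {p = []} _ _ ℓls≡d _ = [] , ℓ ∷ ls , refl , sym ℓls≡d
  factor-boundary {ls = ℓ ∷ ls} {p = p@(_ ∷ _)} {d = d} (strict ∷ stricts) (ℓ≤x ∷ ≤x) ℓls≡pd d≤x
    with Prefix-total {u = ℓ} {v = p} (concat ls , sym ℓls≡pd) (d , refl)
  ... | inj₁ (p′ , p≡ℓp′) with factor-boundary stricts ≤x ls≡p′d d≤x
    where
    ls≡p′d : concat ls ≡ p′ ++ d
    ls≡p′d = ++-cancelˡ ℓ _ _ (trans ℓls≡pd (trans (cong (_++ d) p≡ℓp′) (++-assoc ℓ p′ d)))
  ...   | ls₁ , ls₂ , refl , refl = ℓ ∷ ls₁ , ls₂ , refl , refl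
  factor-boundary {ls = ℓ ∷ ls} {p = p@(_ ∷ _)} {d = d} (strict ∷ _) (ℓ≤x ∷ _) ℓls≡pd d≤x
    | inj₂ (c , t , refl) = ⊥-elim (⊏⇒¬Prefix (strict p (c ∷ t) (λ ()) (λ ()) refl) t≤ℓ)
    where
    d≡tls : d ≡ c ∷ t ++ concat ls
    d≡tls = ++-cancelˡ p _ _ (trans (sym ℓls≡pd) (++-assoc p (c ∷ t) (concat ls)))
    t≤ℓ : Prefix (c ∷ t) (p ++ c ∷ t)
    t≤ℓ = Prefix-by-length (Prefix-trans (concat ls , d≡tls) d≤x) ℓ≤x (length-++-≤ʳ (c ∷ t) {p})

  Chain-drop : ls ≡ ls₁ ++ ls₂ → Chain u ls → InverseLyndon₀ (concat ls₂) → Chain u ls₂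
  Chain-drop {ls₁ = ls₁} refl chain il = record
    { strict        = All.++⁻ʳ ls₁ strict
    ; linked        = Linked-++⁻ʳ ls₁ linked
    ; inverseLyndon = il
    ; extends-u     = All.++⁻ʳ ls₁ extends-u
    }
    where open Chain chain

  Chain-border : Chain u ls → concat ls ≡ p ++ d → d ≢ [] → Prefix d (concat ls) →
                 ∃[ ℓ ] ∃[ ls′ ] Chain u (ℓ ∷ ls′) × d ≡ concat (ℓ ∷ ls′)
  Chain-border {p = p} chain x≡pd d≢[] d≤x
    with factor-boundary strict (Linked-Prefix⇒All linked) x≡pd d≤x
    where open Chain chain
  ... | _ , [] , _ , d≡[] = contradiction d≡[] d≢[]
  ... | _ , ℓ ∷ ls′ , ls≡ , refl = ℓ , ls′ , Chain-drop ls≡ chain il-d , refl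
    where
    open Chain chain
    il-d : InverseLyndon₀ (concat (ℓ ∷ ls′))
    il-d = InverseLyndon₀-border {p = p} (subst (Prefix _) x≡pd d≤x)
                                         (subst InverseLyndon₀ x≡pd inverseLyndon)

  record Overhang (x y p pbar : Word {n}) : Set where
    field
      e k      : Word {n}
      f g      : Fin n
      pbar≡ef  : pbar ≡ e ∷ʳ f
      eg≤p     : Prefix (e ∷ʳ g) p
      g<f      : g <ᶠ f
      pe≡xk    : p ++ e ≡ x ++ k
      kf≤y     : Prefix (k ∷ʳ f) y
      il-xk    : InverseLyndon₀ (x ++ k)

  -- x is inverse Lyndon and p pbar is not, so p pbar reaches beyond x.
  BoundedRightExt⇒Overhang : InverseLyndon₀ x → x ++ y ≡ p ++ v → BoundedRightExt p v pbar →
                             Overhang x y p pbar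
  BoundedRightExt⇒Overhang {x = x} {y = y} {p = p} il-x xy≡pv bre@(_ , _ , _ , _ , pbar≤v , _)
    with BoundedRightExt-shape bre
  ... | e , f , g , refl , eg≤p , g<f = record
    { e = e ; k = proj₁ x≤pe ; f = f ; g = g ; pbar≡ef = refl ; eg≤p = eg≤p ; g<f = g<f
    ; pe≡xk = proj₂ x≤pe
    ; kf≤y  = Prefix-++⁻ x (subst (λ z → Prefix z (x ++ y))
                                   (trans (cong (_∷ʳ f) (proj₂ x≤pe)) (++-assoc x _ [ f ])) pef≤xy)
    ; il-xk = subst InverseLyndon₀ (proj₂ x≤pe) (BoundedRightExt-inner bre (f , [] , refl))
    }
    where
    pef≤xy : Prefix ((p ++ e) ∷ʳ f) (x ++ y)
    pef≤xy = subst₂ Prefix (sym (++-assoc p e [ f ])) (sym xy≡pv) (Prefix-++⁺ p pbar≤v)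
    pef≰x : ¬ Prefix ((p ++ e) ∷ʳ f) x
    pef≰x pef≤x = BoundedRightExt-¬InverseLyndon₀ bre
      (subst InverseLyndon₀ (++-assoc p e [ f ]) (InverseLyndon₀-prefix pef≤x il-x))
    x≤pe : Prefix x (p ++ e)
    x≤pe = Prefix-∷ʳ-stop (y , refl) pef≤xy pef≰x

  -- r is the common part of u and ℓ before their first mismatch; x q cannot reach past it.
  InverseLyndon₀-overhang : Prefix u x → u ⊏ ℓ → InverseLyndon₀ (x ++ q) → Prefix q (ℓ ++ y) →
                            ∃[ r ] Prefix q r × Prefix r x × Prefix r ℓ × length r < length ℓ
  InverseLyndon₀-overhang u≤x u⊏ℓ il q≤ℓy with ⊏-split u⊏ℓ
  ... | r , b , a , b<a , rb≤u , ra≤ℓ =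
    r , q≤r , Prefix-trans ([ b ] , refl) rb≤x , Prefix-trans ([ a ] , refl) ra≤ℓ ,
    subst (_≤ _) (length-∷ʳ r) (Prefix-length ra≤ℓ)
    where
    rb≤x = Prefix-trans rb≤u u≤x
    q≤r = Prefix-∷ʳ-stop q≤ℓy (Prefix-trans ra≤ℓ (_ , refl)) λ ra≤q →
      ¬InverseLyndon₀-++-⊐ rb≤x (⊏-extend (⊏-∷ʳ r b<a) (Prefix-refl _) ra≤q) il

  data StartsAbove (u : Word {n}) : Word {n} → Set where
    empty  : StartsAbove u []
    starts : StrictlyInverseLyndon ℓ → u ⊏ ℓ → StartsAbove u (ℓ ++ y)

  data CanonicalCut (u x y p v pbar : Word {n}) : Set where
    at-end : p ≡ x → v ≡ y → Prefix ℓ y → StrictlyInverseLyndon ℓ → length pbar ≤ length ℓ →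
             CanonicalCut u x y p v pbar
    inside : Chain u (ℓ ∷ ls) → d ≡ concat (ℓ ∷ ls) → x ≡ p ++ d → v ≡ d ++ y →
             length d < length pbar → CanonicalCut u x y p v pbar

  Overhang-at-end : Prefix u x → StrictlyInverseLyndon ℓ → u ⊏ ℓ → x ++ ℓ ++ y ≡ p ++ v →
                    Prefix x p → Overhang x (ℓ ++ y) p pbar → CanonicalCut u x (ℓ ++ y) p v pbar
  Overhang-at-end {x = x} {ℓ = ℓ} {y = y} {p = p} {v = v} u≤x strict u⊏ℓ xy≡pv (p₂ , p≡xp₂)
                  o@record { pbar≡ef = refl }
    with InverseLyndon₀-overhang u≤x u⊏ℓ (Overhang.il-xk o)
                                 (Prefix-trans ([ _ ] , refl) (Overhang.kf≤y o))
  ... | r , k≤r , r≤x , r≤ℓ , |r|<|ℓ| = cut p₂ p≡xp₂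
    where
    open Overhang o
    kf≤ℓ : Prefix (k ∷ʳ f) ℓ
    kf≤ℓ = Prefix-by-length kf≤y (y , refl)
             (subst (_≤ length ℓ) (sym (length-∷ʳ k)) (≤-trans (s≤s (Prefix-length k≤r)) |r|<|ℓ|))
    cut : ∀ p₂ → p ≡ x ++ p₂ → CanonicalCut u x (ℓ ++ y) p v (e ∷ʳ f)
    cut [] p≡x[] = at-end p≡x v≡y (y , refl) strict
                          (subst (λ z → length (z ∷ʳ f) ≤ length ℓ) k≡e (Prefix-length kf≤ℓ))
      where
      p≡x = trans p≡x[] (++-identityʳ x)
      v≡y = ++-cancelˡ x _ _ (trans (cong (_++ v) (sym p≡x)) (sym xy≡pv))
      k≡e : k ≡ e
      k≡e = ++-cancelˡ x _ _ (trans (sym pe≡xk) (cong (_++ e) p≡x))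
    cut (c ∷ p₂) p≡xcp₂ =
      ⊥-elim (StrictlyInverseLyndon⇒¬inner-⊐ {z = c ∷ p₂} strict (λ ()) cp₂ef≤ℓ eg≤ℓ (⊏-∷ʳ e g<f))
      where
      k≡cp₂e : k ≡ c ∷ p₂ ++ e
      k≡cp₂e =
        ++-cancelˡ x _ _ (trans (sym pe≡xk) (trans (cong (_++ e) p≡xcp₂) (++-assoc x (c ∷ p₂) e)))
      cp₂ef≤ℓ : Prefix (c ∷ p₂ ++ e ∷ʳ f) ℓ
      cp₂ef≤ℓ =
        subst (λ z → Prefix z ℓ) (trans (cong (_∷ʳ f) k≡cp₂e) (++-assoc (c ∷ p₂) e [ f ])) kf≤ℓ
      |eg|≤|r| : length (e ∷ʳ g) ≤ length r
      |eg|≤|r| = begin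
        length (e ∷ʳ g)      ≡⟨ length-∷ʳ e ⟩
        suc (length e)       ≤⟨ length-<-∷-++ {s = e} {c = c} p₂ ⟩
        length (c ∷ p₂ ++ e) ≡⟨ cong length k≡cp₂e ⟨
        length k             ≤⟨ Prefix-length k≤r ⟩
        length r             ∎
        where open ≤-Reasoning
      eg≤r : Prefix (e ∷ʳ g) r
      eg≤r = Prefix-by-length (Prefix-trans eg≤p (v , xy≡pv)) (Prefix-trans r≤x (ℓ ++ y , refl))
                              |eg|≤|r|
      eg≤ℓ : Prefix (e ∷ʳ g) ℓ
      eg≤ℓ = Prefix-trans eg≤r r≤ℓ

  Overhang-inside : Chain u ls → concat ls ++ y ≡ p ++ v → ProperPrefix p (concat ls) →
                    Overhang (concat ls) y p pbar → CanonicalCut u (concat ls) y p v pbar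
  Overhang-inside {ls = ls} {y = y} {p = p} {v = v} chain xy≡pv (c , d , x≡pcd)
                  o@record { pbar≡ef = refl } = from-border (Chain-border chain x≡pcd (λ ()) cd≤x)
    where
    open Overhang o
    cd≤e : Prefix (c ∷ d) e
    cd≤e = k , ++-cancelˡ p _ _ (trans pe≡xk (trans (cong (_++ k) x≡pcd) (++-assoc p (c ∷ d) k)))
    cd≤x : Prefix (c ∷ d) (concat ls)
    cd≤x = Prefix-trans cd≤e (Prefix-trans ([ g ] , refl) (Prefix-trans eg≤p (c ∷ d , x≡pcd)))
    v≡cdy : v ≡ c ∷ d ++ y
    v≡cdy =
      ++-cancelˡ p _ _ (trans (sym xy≡pv) (trans (cong (_++ y) x≡pcd) (++-assoc p (c ∷ d) y)))
    from-border : (∃[ ℓ ] ∃[ ls′ ] Chain u (ℓ ∷ ls′) × c ∷ d ≡ concat (ℓ ∷ ls′)) →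
                  CanonicalCut u (concat ls) y p v (e ∷ʳ f)
    from-border (_ , _ , chain′ , cd≡) =
      inside chain′ cd≡ x≡pcd v≡cdy (≤-trans (s≤s (Prefix-length cd≤e)) (length-<-++-∷ e))

  canonical-cut : Chain u (ℓ ∷ ls) → StartsAbove u y → concat (ℓ ∷ ls) ++ y ≡ p ++ v →
                  BoundedRightExt p v pbar → CanonicalCut u (concat (ℓ ∷ ls)) y p v pbar
  canonical-cut {ℓ = ℓ} {ls = ls} {p = p} chain above xy≡pv bre
    with BoundedRightExt⇒Overhang (Chain.inverseLyndon chain) xy≡pv bre
  ... | o with above | Prefix-total {u = concat (ℓ ∷ ls)} {v = p} (_ , Overhang.pe≡xk o) (_ , refl)
  ...   | empty | _ = ⊥-elim (Prefix-≢[] (Overhang.kf≤y o) (∷ʳ≢[] (Overhang.k o)) refl)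
  ...   | starts strict u⊏ℓ′ | inj₁ x≤p =
    Overhang-at-end (Chain⇒Prefix chain) strict u⊏ℓ′ xy≡pv x≤p o
  ...   | _ | inj₂ p<x = Overhang-inside chain xy≡pv p<x o

  ICFL-starts-with-chain : IsICFL w ms → Chain u (ℓ ∷ ls) → StartsAbove u y →
                           w ≡ concat (ℓ ∷ ls) ++ y → ∃[ ms′ ] ms ≡ concat (ℓ ∷ ls) ∷ ms′
  ICFL-starts-with-chain (icfl-inv _) _ empty w≡x[] = [] , cong [_] (trans w≡x[] (++-identityʳ _))
  ICFL-starts-with-chain (icfl-inv il) chain (starts _ u⊏ℓ′) refl =
    ⊥-elim (¬InverseLyndon₀-++-⊐ (Chain⇒Prefix chain) (⊏-extend u⊏ℓ′ (Prefix-refl _) (_ , refl))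
                                  (InverseLyndon⇒₀ il))
  ICFL-starts-with-chain (icfl-new _ w≡pv bre icfl-v pbar≤m) chain above w≡xy
    with canonical-cut chain above (trans (sym w≡xy) w≡pv) bre
  ... | at-end p≡x _ _ _ _ = _ , cong (_∷ _) p≡x
  ... | inside chain′ refl _ v≡dy |d|<|pbar|
    with ICFL-starts-with-chain icfl-v chain′ above v≡dy
  ...   | _ , refl = contradiction (Prefix-length pbar≤m) (<⇒≱ |d|<|pbar|)
  ICFL-starts-with-chain
    (icfl-glue {r = r} {b = b} {m = m} _ w≡pv bre refl icfl-v m≤r) chain above w≡xy
    with canonical-cut chain above (trans (sym w≡xy) w≡pv) bre
  ... | at-end {ℓ = ℓ′} _ refl ℓ′≤v strict′ |pbar|≤|ℓ′| = ⊥-elim (<-irrefl refl m<m)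
    where
    m<m : length m < length m
    m<m = begin-strict
      length m        ≤⟨ Prefix-length m≤r ⟩
      length r        <⟨ length-<-++-∷ r ⟩
      length (r ∷ʳ b) ≤⟨ |pbar|≤|ℓ′| ⟩
      length ℓ′       ≤⟨ ICFL-head-≥-strict-prefix icfl-v ℓ′≤v strict′ ⟩
      length m        ∎
      where open ≤-Reasoning
  ... | inside chain′ refl x≡pd v≡dy _ with ICFL-starts-with-chain icfl-v chain′ above v≡dy
  ...   | ms′ , refl = ms′ , cong (_∷ ms′) (sym x≡pd)

  lastOf-Prefix-all : Linked (flip Prefix) (ℓ ∷ ls) → All (Prefix (lastOf ℓ ls)) (ℓ ∷ ls)
  lastOf-Prefix-all {ℓ = ℓ} {ls = []} _ = Prefix-refl ℓ ∷ []
  lastOf-Prefix-all {ls = _ ∷ _} (ℓ′≤ℓ ∷ linked) with lastOf-Prefix-all linked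
  ... | u≤ℓ′ ∷ u≤ls = Prefix-trans u≤ℓ′ ℓ′≤ℓ ∷ u≤ℓ′ ∷ u≤ls

  Linked-lastOf : ∀ {r} {R : Rel (Word {n}) r} →
                  Linked R ((ℓ ∷ ls) ++ ℓ′ ∷ ls₂) → R (lastOf ℓ ls) ℓ′
  Linked-lastOf {ls = []} (Rℓℓ′ ∷ _) = Rℓℓ′
  Linked-lastOf {ls = _ ∷ ls} (_ ∷ linked) = Linked-lastOf {ls = ls} linked

  ⪯in-¬Prefix⇒⊏ : ℓ ⪯in u → ¬ Prefix ℓ u → u ⊏ ℓ
  ⪯in-¬Prefix⇒⊏ {ℓ = ℓ} (inj₁ refl) ℓ≰u = contradiction (Prefix-refl ℓ) ℓ≰u
  ⪯in-¬Prefix⇒⊏ (inj₂ ℓ≺u) ℓ≰u with ≺in⇒⊐ ℓ≺u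
  ... | inj₁ (c , s , u≡ℓcs) = contradiction (c ∷ s , u≡ℓcs) ℓ≰u
  ... | inj₂ u⊏ℓ = u⊏ℓ

  maximal-chain-StartsAbove : All AntiLyndon ls₂ → Linked (λ x y → y ⪯in x) ((ℓ ∷ ls) ++ ls₂) →
                              StopsBefore (lastOf ℓ ls) ls₂ → StartsAbove (lastOf ℓ ls) (concat ls₂)
  maximal-chain-StartsAbove {ls₂ = []} _ _ _ = empty
  maximal-chain-StartsAbove {ls₂ = _ ∷ _} {ls = ls} (anti ∷ _) linked stop =
    starts (AntiLyndon⇒StrictlyInverseLyndon anti)
           (⪯in-¬Prefix⇒⊏ (Linked-lastOf {ls = ls} linked) stop)

proposition9p8 : ∀ {n : ℕ} (w : Word {n}) → w ≢ [] →
    (ls : List (Word {n})) → IsCFLin w ls →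
    (ℓ₁ : Word {n}) (chain : List (Word {n})) → InitialMaxPrefixChain ls ℓ₁ chain →
    (ms : List (Word {n})) → IsICFL w ms →
    InverseLyndon (concat (ℓ₁ ∷ chain)) →
    ∃ λ ms' → ms ≡ concat (ℓ₁ ∷ chain) ∷ ms'
proposition9p8 _ _ _ (anti , concat≡w , ⪰in-linked) ℓ₁ chain (rest , refl , linked , stop) _ icfl il =
  ICFL-starts-with-chain icfl factors
    (maximal-chain-StartsAbove (All.++⁻ʳ (ℓ₁ ∷ chain) anti) ⪰in-linked stop)
    (trans (sym concat≡w) (sym (concat-++ (ℓ₁ ∷ chain) rest)))
  where
  factors : Chain (lastOf ℓ₁ chain) (ℓ₁ ∷ chain)
  factors = record
    { strict        = All.map AntiLyndon⇒StrictlyInverseLyndon (All.++⁻ˡ (ℓ₁ ∷ chain) anti)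
    ; linked        = linked
    ; inverseLyndon = InverseLyndon⇒₀ il
    ; extends-u     = lastOf-Prefix-all linked
    }
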